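{- Let $\mathcal{O}$ be an order of $K$ and $(r,\tau),(r',\tau')\in\mathbb{Z}/f\mathbb{Z}\times H^{\mathcal{O}}(\mathfrak{N})$. Writing $\tau^*=\frac{ -1}{fN\tau}$ and $\tau'^*=\frac{ -1}{fN\tau'}$, one has $(r,\tau)\sim_f(r',\tau')$ if and only if $(r',\tau^*)\sim_f(r,\tau'^*)$.
   Context: $K$ is a real quadratic field of discriminant $d_K$ with fixed embedding in $\mathbb{R}$ and non-trivial automorphism $\sigma$. $N=\prod l_i^{e_i}$ with distinct primes $l_i$ split in $K$, $\mathfrak{N}=\prod\eta_i^{e_i}$ with $\eta_i$ a prime of $\mathcal{O}_K$ above $l_i$, and $f$ is a positive integer coprime to $Nd_K$. For $\tau\in K\setminus\mathbb{Q}$, $\Lambda_\tau=\mathbb{Z}+\tau\mathbb{Z}$ and $\mathcal{O}_\tau=\{\lambda:\lambda\Lambda_\tau\subseteq\Lambda_\tau\}$. $H^{\mathcal{O}}(\mathfrak{N})=\{\tau\in K\setminus\mathbb{Q}:(\mathfrak{N}\cap\mathcal{O}_\tau)\Lambda_\tau=\Lambda_{N\tau},\ \tau-\tau^\sigma>0,\ \mathcal{O}_\tau=\mathcal{O}\}$. For $(r,\tau),(r',\tau')\in\mathbb{Z}/f\mathbb{Z}\times(K\setminus\mathbb{Q})$, $(r,\tau)\sim_f(r',\tau')$ means there exists $\gamma=\begin{pmatrix}a&b\\c&d\end{pmatrix}\in\Gamma_0(fN)$ with $d^{ -1}r\equiv r'\pmod f$ and $\tau'=\frac{a\tau+b}{c\tau+d}$.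 -}

module Defs where

open import Level using (0ℓ)
open import Data.Nat as ℕ using (ℕ; zero; suc)
open import Data.Nat.Primality using (Prime)
open import Data.Integer as ℤ using (ℤ; +_)
open import Data.Integer.Divisibility as ℤD using ()
open import Data.Rational as ℚ using (ℚ; 0ℚ; 1ℚ; _/_; 1/_; ≢-nonZero)
open import Data.Product using (Σ; ∃; ∃-syntax; _×_; _,_)
open import Data.Sum using (_⊎_)
open import Data.List using (List; []; _∷_; map)
open import Data.List.Relation.Unary.All using (All)
open import Data.List.Relation.Unary.Unique.Propositional using (Unique)
open import Relation.Unary using (Pred; _≐_; _∈_; _⊆_)
open import Relation.Nullary using (¬_; yes; no)
open import Relation.Binary.PropositionalEquality using (_≡_; _≢_)

SquareFree : ℕ → Set
SquareFree D = ∀ p → Prime p → ¬ ((p ℕ.* p) Data.Nat.Divisibility.∣ D)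
  where import Data.Nat.Divisibility

-- An element re + im·√D of K = ℚ(√D) (D fixed in module QF below).
-- The fixed real embedding sends √D to the positive square root of D.
record K : Set where
  constructor _+√·_
  field
    re : ℚ
    im : ℚ
open K public

Subset : Set₁
Subset = Pred K 0ℓ

-- total inverse on ℚ (value at 0 is irrelevant; only used at nonzero arguments)
invℚ : ℚ → ℚ
invℚ q with q ℚ.≟ 0ℚ
... | yes _ = 0ℚ
... | no q≢0 = 1/_ q {{≢-nonZero q≢0}}

ℤ→ℚ : ℤ → ℚ
ℤ→ℚ z = z / 1

IsIntℚ : ℚ → Set
IsIntℚ q = ∃[ z ] q ≡ ℤ→ℚ z

Cong : ℕ → ℤ → ℤ → Set
Cong f x y = (+ f) ℤD.∣ (x ℤ.- y)

-- A factor l^e of N together with the chosen prime η of O_K above l.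
record Factor : Set₁ where
  constructor fac
  field
    l : ℕ
    e : ℕ
    η : Subset
open Factor public

module QF (D : ℕ) where

  infixl 6 _+K_ _-K_
  infixl 7 _*K_ _/K_
  infix 8 -K_

  ι : ℤ → K
  ι z = ℤ→ℚ z +√· 0ℚ

  ιℕ : ℕ → K
  ιℕ n = ι (+ n)

  0K 1K : K
  0K = 0ℚ +√· 0ℚ
  1K = 1ℚ +√· 0ℚ

  Dℚ : ℚ
  Dℚ = ℤ→ℚ (+ D)

  _+K_ : K → K → K
  (a +√· b) +K (c +√· d) = (a ℚ.+ c) +√· (b ℚ.+ d)

  -K_ : K → K
  -K (a +√· b) = (ℚ.- a) +√· (ℚ.- b)

  _-K_ : K → K → K
  x -K y = x +K (-K y)

  _*K_ : K → K → K
  (a +√· b) *K (c +√· d) = (a ℚ.* c ℚ.+ Dℚ ℚ.* (b ℚ.* d)) +√· (a ℚ.* d ℚ.+ b ℚ.* c)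

  σ : K → K
  σ (a +√· b) = a +√· (ℚ.- b)

  trace norm : K → ℚ
  trace (a +√· b) = a ℚ.+ a
  norm (a +√· b) = a ℚ.* a ℚ.- Dℚ ℚ.* (b ℚ.* b)

  -- multiplicative inverse (x⁻¹ = σ x / N(x)); 0 ↦ 0
  invK : K → K
  invK x = (re (σ x) ℚ.* invℚ (norm x)) +√· (im (σ x) ℚ.* invℚ (norm x))

  _/K_ : K → K → K
  x /K y = x *K invK y

  -- positivity of a + b√D under the fixed real embedding (√D > 0)
  Pos : K → Set
  Pos (a +√· b) =
      (ℚ.0ℚ ℚ.≤ a × ℚ.0ℚ ℚ.≤ b × ¬ (a ≡ 0ℚ × b ≡ 0ℚ))
    ⊎ (ℚ.0ℚ ℚ.< a × b ℚ.< 0ℚ × Dℚ ℚ.* (b ℚ.* b) ℚ.< a ℚ.* a)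
    ⊎ (a ℚ.< 0ℚ × ℚ.0ℚ ℚ.< b × a ℚ.* a ℚ.< Dℚ ℚ.* (b ℚ.* b))

  dK : ℕ
  dK with D ℕ.% 4
  ... | 1 = D
  ... | _ = 4 ℕ.* D

  -- ring of integers: elements whose (minimal/characteristic) polynomial
  -- X² - Tr(x) X + N(x) has integer coefficients
  𝒪K : Subset
  𝒪K x = IsIntℚ (trace x) × IsIntℚ (norm x)

  -- additive subgroup generated by the products ab (a ∈ A, b ∈ B):
  -- product of ideals, and product of an ideal with a lattice
  data _⊙_ (A B : Subset) : Subset where
    gen  : ∀ {a b} → a ∈ A → b ∈ B → (a *K b) ∈ (A ⊙ B)
    zro  : 0K ∈ (A ⊙ B)
    add  : ∀ {x y} → x ∈ (A ⊙ B) → y ∈ (A ⊙ B) → (x +K y) ∈ (A ⊙ B)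
    neg  : ∀ {x} → x ∈ (A ⊙ B) → (-K x) ∈ (A ⊙ B)

  _∩_ : Subset → Subset → Subset
  (A ∩ B) x = A x × B x

  σ-set : Subset → Subset
  σ-set A x = A (σ x)

  Λ : K → Subset
  Λ τ x = ∃[ m ] ∃[ n ] x ≡ ι m +K (ι n *K τ)

  𝒪of : K → Subset
  𝒪of τ x = ∀ y → y ∈ Λ τ → (x *K y) ∈ Λ τ

  IsOrder : Subset → Set
  IsOrder O =
      1K ∈ O
    × (∀ {x y} → x ∈ O → y ∈ O → (x +K y) ∈ O)
    × (∀ {x} → x ∈ O → (-K x) ∈ O)
    × (∀ {x y} → x ∈ O → y ∈ O → (x *K y) ∈ O)
    × (∃[ ω₁ ] ∃[ ω₂ ]
         ((re ω₁ ℚ.* im ω₂ ℚ.- re ω₂ ℚ.* im ω₁ ≢ 0ℚ)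
         × (∀ x → x ∈ O → ∃[ m ] ∃[ n ] x ≡ ι m *K ω₁ +K ι n *K ω₂)
         × (∀ m n → (ι m *K ω₁ +K ι n *K ω₂) ∈ O)))

  IsIdeal : Subset → Set
  IsIdeal I =
      I ⊆ 𝒪K
    × 0K ∈ I
    × (∀ {x y} → x ∈ I → y ∈ I → (x +K y) ∈ I)
    × (∀ {a x} → a ∈ 𝒪K → x ∈ I → (a *K x) ∈ I)

  IsPrimeIdeal : Subset → Set
  IsPrimeIdeal P =
      IsIdeal P
    × ¬ (1K ∈ P)
    × (∃[ x ] (x ∈ P × x ≢ 0K))
    × (∀ {a b} → a ∈ 𝒪K → b ∈ 𝒪K → (a *K b) ∈ P → a ∈ P ⊎ b ∈ P)

  ℕ𝒪K : ℕ → Subset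
  ℕ𝒪K n x = ∃[ y ] (y ∈ 𝒪K × x ≡ ιℕ n *K y)

  Splits : ℕ → Set₁
  Splits l = ∃[ 𝔭 ] (IsPrimeIdeal 𝔭 × (ℕ𝒪K l ≐ (𝔭 ⊙ σ-set 𝔭)) × ¬ (𝔭 ≐ σ-set 𝔭))

  _^I_ : Subset → ℕ → Subset
  I ^I zero = 𝒪K
  I ^I suc e = I ⊙ (I ^I e)

  NOf : List Factor → ℕ
  NOf [] = 1
  NOf (φ ∷ φs) = (l φ ℕ.^ e φ) ℕ.* NOf φs

  𝔑Of : List Factor → Subset
  𝔑Of [] = 𝒪K
  𝔑Of (φ ∷ φs) = (η φ ^I e φ) ⊙ 𝔑Of φs

  ValidFactor : Factor → Set₁
  ValidFactor φ = Prime (l φ) × Splits (l φ) × 1 ℕ.≤ e φ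
                × IsPrimeIdeal (η φ) × ιℕ (l φ) ∈ η φ

  ValidFactors : List Factor → Set₁
  ValidFactors φs = Unique (map l φs) × All ValidFactor φs

  Irrational : K → Set
  Irrational τ = im τ ≢ 0ℚ

  H : Subset → ℕ → Subset → Subset
  H O N 𝔑 τ =
      Irrational τ
    × (((𝔑 ∩ 𝒪of τ) ⊙ Λ τ) ≐ Λ (ιℕ N *K τ))
    × Pos (τ -K σ τ)
    × (𝒪of τ ≐ O)

  mob : ℤ → ℤ → ℤ → ℤ → K → K
  mob a b c d τ = (ι a *K τ +K ι b) /K (ι c *K τ +K ι d)

  -- (r,τ) ∼_f (r',τ') (level fN), residues mod f represented by integers
  Sim : ℕ → ℕ → ℤ → K → ℤ → K → Set
  Sim f N r τ r' τ' =
    ∃[ a ] ∃[ b ] ∃[ c ] ∃[ d ]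
      ( (a ℤ.* d ℤ.- b ℤ.* c ≡ + 1)
      × ((+ (f ℕ.* N)) ℤD.∣ c)
      × (∃[ d⁻¹ ] (Cong f (d⁻¹ ℤ.* d) (+ 1) × Cong f (d⁻¹ ℤ.* r) r'))
      × (τ' ≡ mob a b c d τ))

  star : ℕ → ℕ → K → K
  star f N τ = (-K 1K) /K (ιℕ (f ℕ.* N) *K τ)

{-# OPTIONS --safe #-}
module Submission where

-- With M = fN, τ* = -1/(Mτ) is characterised by τ · Mτ* = -1, a relation symmetric in τ and τ*.
-- If γ = (a b; kM d) ∈ Γ₀(M) carries τ to τ', then its conjugate (d -k; -Mb a) by the Fricke
-- involution carries τ* to τ'*. As ad - bc = 1 and f ∣ c, the new lower-right entry a is inverse
-- to d modulo f, so d⁻¹r ≡ r' turns into a⁻¹r' ≡ dr' ≡ r. The converse is the same argument with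
-- τ and τ* exchanged.

open import Defs
open import Level using (0ℓ)
open import Data.Nat as ℕ using (ℕ; suc; _<_; _*_; NonZero)
import Data.Nat.Properties as ℕP
open import Data.Nat.Coprimality as Coprimality using (Coprime)
open import Data.Nat.Divisibility as ℕD using (divides)
open import Data.Nat.Primality using (prime⇒nonZero)
open import Data.Nat.Primality.Factorisation using (factorise)
open import Data.Nat.ListAction using (product)
open import Data.Integer as ℤ using (ℤ; +_)
import Data.Integer.Properties as ℤP
import Data.Integer.Divisibility.Signed as ℤS
open import Data.Integer.Tactic.RingSolver using (solve-∀)
open import Data.Rational as ℚ using (ℚ; 0ℚ; 1ℚ; mkℚ; toℚᵘ)
import Data.Rational.Properties as ℚP
import Data.Rational.Unnormalised as ℚᵘ
import Data.Rational.Unnormalised.Properties as ℚᵘP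
open import Data.List using (List; []; _∷_)
open import Data.List.Relation.Unary.All using (All; []; _∷_)
open import Data.Maybe using (Maybe; just; nothing)
open import Data.Empty using (⊥-elim)
open import Data.Product using (∃-syntax; _,_; _×_; proj₁)
open import Function.Bundles using (_⇔_; mk⇔)
open import Relation.Nullary using (¬_; yes; no)
open import Relation.Nullary.Decidable using (recompute)
open import Relation.Binary.PropositionalEquality
open import Algebra.Bundles using (CommutativeRing)
open import Algebra.Structures {A = K} _≡_ using (IsCommutativeRing)
import Algebra.Solver.Ring.AlmostCommutativeRing as ACR
open import Algebra.Properties.Group ℚP.+-0-group using (x∙y⁻¹≈ε⇒x≈y)
open import Data.Rational.Solver using (module +-*-Solver)

ℤ→ℚ≡mkℚ : ∀ z → ℤ→ℚ z ≡ mkℚ z 0 (Coprimality.sym (Coprimality.1-coprimeTo _))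
ℤ→ℚ≡mkℚ z = ℚP.↥p/↧p≡p _

toℚᵘ-ℤ→ℚ : ∀ z → toℚᵘ (ℤ→ℚ z) ≡ ℚᵘ.mkℚᵘ z 0
toℚᵘ-ℤ→ℚ z rewrite ℤ→ℚ≡mkℚ z = refl

ℤ→ℚ-injective : ∀ {x y} → ℤ→ℚ x ≡ ℤ→ℚ y → x ≡ y
ℤ→ℚ-injective {x} {y} eq = cong ℚ.ℚ.numerator (trans (sym (ℤ→ℚ≡mkℚ x)) (trans eq (ℤ→ℚ≡mkℚ y)))

mkℚᵘ≃toℚᵘ⇒ℤ→ℚ≡ : ∀ {z p} → ℚᵘ.mkℚᵘ z 0 ℚᵘ.≃ toℚᵘ p → ℤ→ℚ z ≡ p
mkℚᵘ≃toℚᵘ⇒ℤ→ℚ≡ {z} eq = ℚP.toℚᵘ-injective (ℚᵘP.≃-trans (ℚᵘP.≃-reflexive (toℚᵘ-ℤ→ℚ z)) eq)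

ℤ→ℚ-+ : ∀ x y → ℤ→ℚ (x ℤ.+ y) ≡ ℤ→ℚ x ℚ.+ ℤ→ℚ y
ℤ→ℚ-+ x y = mkℚᵘ≃toℚᵘ⇒ℤ→ℚ≡ (begin
  ℚᵘ.mkℚᵘ (x ℤ.+ y) 0              ≈⟨ ℚᵘ.*≡* numerators ⟩
  ℚᵘ.mkℚᵘ x 0 ℚᵘ.+ ℚᵘ.mkℚᵘ y 0     ≡⟨ sym (cong₂ ℚᵘ._+_ (toℚᵘ-ℤ→ℚ x) (toℚᵘ-ℤ→ℚ y)) ⟩
  toℚᵘ (ℤ→ℚ x) ℚᵘ.+ toℚᵘ (ℤ→ℚ y)   ≈⟨ ℚᵘP.≃-sym (ℚP.toℚᵘ-homo-+ (ℤ→ℚ x) (ℤ→ℚ y)) ⟩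
  toℚᵘ (ℤ→ℚ x ℚ.+ ℤ→ℚ y)           ∎)
  where
  open ℚᵘP.≃-Reasoning
  numerators : (x ℤ.+ y) ℤ.* + 1 ≡ (x ℤ.* + 1 ℤ.+ y ℤ.* + 1) ℤ.* + 1
  numerators = trans (ℤP.*-identityʳ _)
    (sym (trans (ℤP.*-identityʳ _) (cong₂ ℤ._+_ (ℤP.*-identityʳ x) (ℤP.*-identityʳ y))))

ℤ→ℚ-* : ∀ x y → ℤ→ℚ (x ℤ.* y) ≡ ℤ→ℚ x ℚ.* ℤ→ℚ y
ℤ→ℚ-* x y = mkℚᵘ≃toℚᵘ⇒ℤ→ℚ≡ (begin
  ℚᵘ.mkℚᵘ (x ℤ.* y) 0              ≡⟨ sym (cong₂ ℚᵘ._*_ (toℚᵘ-ℤ→ℚ x) (toℚᵘ-ℤ→ℚ y)) ⟩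
  toℚᵘ (ℤ→ℚ x) ℚᵘ.* toℚᵘ (ℤ→ℚ y)   ≈⟨ ℚᵘP.≃-sym (ℚP.toℚᵘ-homo-* (ℤ→ℚ x) (ℤ→ℚ y)) ⟩
  toℚᵘ (ℤ→ℚ x ℚ.* ℤ→ℚ y)           ∎)
  where open ℚᵘP.≃-Reasoning

ℤ→ℚ-neg : ∀ x → ℤ→ℚ (ℤ.- x) ≡ ℚ.- ℤ→ℚ x
ℤ→ℚ-neg x = mkℚᵘ≃toℚᵘ⇒ℤ→ℚ≡ (begin
  ℚᵘ.mkℚᵘ (ℤ.- x) 0     ≡⟨ sym (cong ℚᵘ.-_ (toℚᵘ-ℤ→ℚ x)) ⟩
  ℚᵘ.- toℚᵘ (ℤ→ℚ x)     ≈⟨ ℚᵘP.≃-sym (ℚP.toℚᵘ-homo‿- (ℤ→ℚ x)) ⟩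
  toℚᵘ (ℚ.- ℤ→ℚ x)      ∎)
  where open ℚᵘP.≃-Reasoning

p*p≡0⇒p≡0 : ∀ p → p ℚ.* p ≡ 0ℚ → p ≡ 0ℚ
p*p≡0⇒p≡0 p p*p≡0 with p ℚ.≟ 0ℚ
... | yes p≡0 = p≡0
... | no p≢0 = ⊥-elim (ℚP.1≢0 (begin
  1ℚ                          ≡⟨ sym (ℚP.*-identityʳ 1ℚ) ⟩
  1ℚ ℚ.* 1ℚ                   ≡⟨ sym (cong₂ ℚ._*_ p*p⁻¹≡1 p*p⁻¹≡1) ⟩
  (p ℚ.* p⁻¹) ℚ.* (p ℚ.* p⁻¹)  ≡⟨ solve 2 (λ p q → (p :* q) :* (p :* q) := (p :* p) :* (q :* q)) refl p p⁻¹ ⟩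
  (p ℚ.* p) ℚ.* (p⁻¹ ℚ.* p⁻¹)  ≡⟨ cong (ℚ._* (p⁻¹ ℚ.* p⁻¹)) p*p≡0 ⟩
  0ℚ ℚ.* (p⁻¹ ℚ.* p⁻¹)         ≡⟨ ℚP.*-zeroˡ (p⁻¹ ℚ.* p⁻¹) ⟩
  0ℚ                          ∎))
  where
  open ≡-Reasoning
  open +-*-Solver
  instance _ = ℚ.≢-nonZero p≢0
  p⁻¹ : ℚ
  p⁻¹ = ℚ.1/ p
  p*p⁻¹≡1 : p ℚ.* p⁻¹ ≡ 1ℚ
  p*p⁻¹≡1 = ℚP.*-inverseʳ p

invℚ-inverseʳ : ∀ q → q ≢ 0ℚ → q ℚ.* invℚ q ≡ 1ℚ
invℚ-inverseʳ q q≢0 with q ℚ.≟ 0ℚ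
... | yes q≡0 = ⊥-elim (q≢0 q≡0)
... | no q≢0′ = ℚP.*-inverseʳ q {{ℚ.≢-nonZero q≢0′}}

IsRationalSquare : ℕ → Set
IsRationalSquare D = ∃[ t ] t ℚ.* t ≡ ℤ→ℚ (+ D)

module _ {D : ℕ} (1<D : 1 < D) (D-squareFree : SquareFree D) where

  square≢squareFree : ∀ u → u * u ≢ D
  square≢squareFree 0 eq = ℕP.<⇒≢ (ℕP.<-trans ℕ.z<s 1<D) eq
  square≢squareFree 1 eq = ℕP.<⇒≢ 1<D eq
  square≢squareFree u@(suc (suc _)) eq with factorise u
  ... | record { factors = [] ; isFactorisation = () }
  ... | record { factors = p ∷ ps ; isFactorisation = u≡p*ps ; factorsPrime = p-prime ∷ _ } =
    D-squareFree p p-prime (subst ((p * p) ℕD.∣_) eq (ℕD.*-pres-∣ p∣u p∣u))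
    where
    p∣u : p ℕD.∣ u
    p∣u = divides (product ps) (trans u≡p*ps (ℕP.*-comm p _))

  squareFree⇒¬IsRationalSquare : ¬ IsRationalSquare D
  squareFree⇒¬IsRationalSquare (t@(mkℚ n d coprime) , t*t≡D) =
    square≢squareFree u (trans u*u≡D*v*v (trans (cong (λ w → D * (w * w)) v≡1) (ℕP.*-identityʳ D)))
    where
    u v : ℕ
    u = ℤ.∣ n ∣
    v = suc d
    cross-multiplied : n ℤ.* n ℤ.* + 1 ≡ + D ℤ.* + (v * v)
    cross-multiplied with ℚᵘP.≃-trans (ℚᵘP.≃-sym (ℚP.toℚᵘ-homo-* t t))
                            (ℚᵘP.≃-reflexive (trans (cong toℚᵘ t*t≡D) (toℚᵘ-ℤ→ℚ (+ D))))
    ... | ℚᵘ.*≡* eq = eq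
    u*u≡D*v*v : u * u ≡ D * (v * v)
    u*u≡D*v*v = trans (sym (ℤP.abs-* n n))
      (trans (cong ℤ.∣_∣ (sym (ℤP.*-identityʳ (n ℤ.* n))))
      (trans (cong ℤ.∣_∣ cross-multiplied) (ℤP.abs-* (+ D) (+ (v * v)))))
    u-coprime-v : Coprime u v
    u-coprime-v = recompute (Coprimality.coprime? u v) coprime
    v∣u : v ℕD.∣ u
    v∣u = Coprimality.coprime-divisor (Coprimality.sym u-coprime-v)
            (divides (D * v) (trans u*u≡D*v*v (sym (ℕP.*-assoc D v v))))
    v≡1 : v ≡ 1
    v≡1 = u-coprime-v (v∣u , ℕD.∣-refl)

square≡D*square⇒≡0 : ∀ {D} → ¬ IsRationalSquare D → ∀ p q →
                     p ℚ.* p ≡ ℤ→ℚ (+ D) ℚ.* (q ℚ.* q) → p ≡ 0ℚ × q ≡ 0ℚ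
square≡D*square⇒≡0 {D} D-nonSquare p q p*p≡D*q*q with q ℚ.≟ 0ℚ
... | yes refl = p*p≡0⇒p≡0 p (trans p*p≡D*q*q (D*0≡0 (ℤ→ℚ (+ D)))) , refl
  where
  open +-*-Solver
  D*0≡0 : ∀ D → D ℚ.* (0ℚ ℚ.* 0ℚ) ≡ 0ℚ
  D*0≡0 = solve 1 (λ D → D :* (con 0ℚ :* con 0ℚ) := con 0ℚ) refl
... | no q≢0 = ⊥-elim (D-nonSquare (p ℚ.* q⁻¹ , (begin
  (p ℚ.* q⁻¹) ℚ.* (p ℚ.* q⁻¹)     ≡⟨ solve 2 (λ p r → (p :* r) :* (p :* r) := (p :* p) :* (r :* r)) refl p q⁻¹ ⟩
  (p ℚ.* p) ℚ.* (q⁻¹ ℚ.* q⁻¹)     ≡⟨ cong (ℚ._* (q⁻¹ ℚ.* q⁻¹)) p*p≡D*q*q ⟩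
  (Dℚ ℚ.* (q ℚ.* q)) ℚ.* (q⁻¹ ℚ.* q⁻¹) ≡⟨ solve 3 (λ D q r → (D :* (q :* q)) :* (r :* r)
                                                    := D :* ((q :* r) :* (q :* r))) refl Dℚ q q⁻¹ ⟩
  Dℚ ℚ.* ((q ℚ.* q⁻¹) ℚ.* (q ℚ.* q⁻¹)) ≡⟨ cong (λ w → Dℚ ℚ.* (w ℚ.* w)) (ℚP.*-inverseʳ q) ⟩
  Dℚ ℚ.* (1ℚ ℚ.* 1ℚ)               ≡⟨ ℚP.*-identityʳ Dℚ ⟩
  Dℚ                               ∎)))
  where
  open ≡-Reasoning
  open +-*-Solver
  instance _ = ℚ.≢-nonZero q≢0
  q⁻¹ : ℚ
  q⁻¹ = ℚ.1/ q
  Dℚ : ℚ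
  Dℚ = ℤ→ℚ (+ D)

NOf-nonZero : ∀ {D φs} → All (QF.ValidFactor D) φs → NonZero (QF.NOf D φs)
NOf-nonZero [] = _
NOf-nonZero {φs = φ ∷ _} (valid ∷ valids) =
  ℕP.m*n≢0 _ _ {{ℕP.m^n≢0 (l φ) (e φ) {{prime⇒nonZero (proj₁ valid)}}}} {{NOf-nonZero valids}}

det≡1⇒Cong-*-inverse : ∀ f a b c d → a ℤ.* d ℤ.- b ℤ.* c ≡ + 1 → + f ℤS.∣ c →
                       Cong f (d ℤ.* a) (+ 1)
det≡1⇒Cong-*-inverse f a b c d det f∣c =
  ℤS.∣⇒∣ᵤ (subst (+ f ℤS.∣_) (trans (sym (bc≡da-det a b c d)) (cong (λ w → d ℤ.* a ℤ.- w) det))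
                 (ℤS.∣n⇒∣m*n b f∣c))
  where
  bc≡da-det : ∀ a b c d → d ℤ.* a ℤ.- (a ℤ.* d ℤ.- b ℤ.* c) ≡ b ℤ.* c
  bc≡da-det = solve-∀

Cong-*-invert : ∀ f d e r r' → Cong f (e ℤ.* d) (+ 1) → Cong f (e ℤ.* r) r' → Cong f (d ℤ.* r') r
Cong-*-invert f d e r r' ed≡1 er≡r' = ℤS.∣⇒∣ᵤ (subst (+ f ℤS.∣_) (sym (regroup d e r r'))
  (ℤS.∣m∣n⇒∣m-n (ℤS.∣n⇒∣m*n r (ℤS.∣ᵤ⇒∣ ed≡1)) (ℤS.∣n⇒∣m*n d (ℤS.∣ᵤ⇒∣ er≡r'))))
  where
  regroup : ∀ d e r r' → d ℤ.* r' ℤ.- r ≡ r ℤ.* (e ℤ.* d ℤ.- + 1) ℤ.- d ℤ.* (e ℤ.* r ℤ.- r')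
  regroup = solve-∀

module KRing (D : ℕ) where
  open QF D

  +K-assoc : ∀ x y z → (x +K y) +K z ≡ x +K (y +K z)
  +K-assoc (a +√· b) (c +√· d) (e +√· f) = cong₂ _+√·_ (ℚP.+-assoc a c e) (ℚP.+-assoc b d f)

  +K-comm : ∀ x y → x +K y ≡ y +K x
  +K-comm (a +√· b) (c +√· d) = cong₂ _+√·_ (ℚP.+-comm a c) (ℚP.+-comm b d)

  +K-identityˡ : ∀ x → 0K +K x ≡ x
  +K-identityˡ (a +√· b) = cong₂ _+√·_ (ℚP.+-identityˡ a) (ℚP.+-identityˡ b)

  +K-identityʳ : ∀ x → x +K 0K ≡ x
  +K-identityʳ (a +√· b) = cong₂ _+√·_ (ℚP.+-identityʳ a) (ℚP.+-identityʳ b)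

  -K-inverseˡ : ∀ x → (-K x) +K x ≡ 0K
  -K-inverseˡ (a +√· b) = cong₂ _+√·_ (ℚP.+-inverseˡ a) (ℚP.+-inverseˡ b)

  -K-inverseʳ : ∀ x → x +K (-K x) ≡ 0K
  -K-inverseʳ (a +√· b) = cong₂ _+√·_ (ℚP.+-inverseʳ a) (ℚP.+-inverseʳ b)

  *K-assoc : ∀ x y z → (x *K y) *K z ≡ x *K (y *K z)
  *K-assoc (a +√· b) (c +√· d) (e +√· f) = cong₂ _+√·_
    (solve 7 (λ a b c d e f D → (a :* c :+ D :* (b :* d)) :* e :+ D :* ((a :* d :+ b :* c) :* f)
                                := a :* (c :* e :+ D :* (d :* f)) :+ D :* (b :* (c :* f :+ d :* e)))
            refl a b c d e f Dℚ)
    (solve 7 (λ a b c d e f D → (a :* c :+ D :* (b :* d)) :* f :+ (a :* d :+ b :* c) :* e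
                                := a :* (c :* f :+ d :* e) :+ b :* (c :* e :+ D :* (d :* f)))
            refl a b c d e f Dℚ)
    where open +-*-Solver

  *K-comm : ∀ x y → x *K y ≡ y *K x
  *K-comm (a +√· b) (c +√· d) = cong₂ _+√·_
    (cong₂ ℚ._+_ (ℚP.*-comm a c) (cong (Dℚ ℚ.*_) (ℚP.*-comm b d)))
    (trans (ℚP.+-comm (a ℚ.* d) (b ℚ.* c)) (cong₂ ℚ._+_ (ℚP.*-comm b c) (ℚP.*-comm a d)))

  *K-identityˡ : ∀ x → 1K *K x ≡ x
  *K-identityˡ (a +√· b) = cong₂ _+√·_
    (solve 3 (λ a b D → con 1ℚ :* a :+ D :* (con 0ℚ :* b) := a) refl a b Dℚ)
    (solve 2 (λ a b → con 1ℚ :* b :+ con 0ℚ :* a := b) refl a b)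
    where open +-*-Solver

  *K-identityʳ : ∀ x → x *K 1K ≡ x
  *K-identityʳ x = trans (*K-comm x 1K) (*K-identityˡ x)

  *K-distribʳ-+K : ∀ x y z → (y +K z) *K x ≡ (y *K x) +K (z *K x)
  *K-distribʳ-+K (a +√· b) (c +√· d) (e +√· f) = cong₂ _+√·_
    (solve 7 (λ a b c d e f D → (c :+ e) :* a :+ D :* ((d :+ f) :* b)
                                := (c :* a :+ D :* (d :* b)) :+ (e :* a :+ D :* (f :* b)))
            refl a b c d e f Dℚ)
    (solve 6 (λ a b c d e f → (c :+ e) :* b :+ (d :+ f) :* a
                              := (c :* b :+ d :* a) :+ (e :* b :+ f :* a))
            refl a b c d e f)
    where open +-*-Solver

  *K-distribˡ-+K : ∀ x y z → x *K (y +K z) ≡ (x *K y) +K (x *K z)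
  *K-distribˡ-+K x y z = begin
    x *K (y +K z)           ≡⟨ *K-comm x (y +K z) ⟩
    (y +K z) *K x           ≡⟨ *K-distribʳ-+K x y z ⟩
    y *K x +K z *K x        ≡⟨ cong₂ _+K_ (*K-comm y x) (*K-comm z x) ⟩
    x *K y +K x *K z        ∎
    where open ≡-Reasoning

  *K-invK : ∀ x → norm x ≢ 0ℚ → x *K invK x ≡ 1K
  *K-invK (a +√· b) norm≢0 = cong₂ _+√·_
    (trans (solve 4 (λ a b D i → a :* (a :* i) :+ D :* (b :* ((:- b) :* i))
                                 := (a :* a :- D :* (b :* b)) :* i)
                     refl a b Dℚ (invℚ (norm (a +√· b))))
           (invℚ-inverseʳ _ norm≢0))
    (solve 3 (λ a b i → a :* ((:- b) :* i) :+ b :* (a :* i) := con 0ℚ)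
              refl a b (invℚ (norm (a +√· b))))
    where open +-*-Solver

  +K-*K-isCommutativeRing : IsCommutativeRing _+K_ _*K_ -K_ 0K 1K
  +K-*K-isCommutativeRing = record
    { isRing = record
      { +-isAbelianGroup = record
        { isGroup = record
          { isMonoid = record
            { isSemigroup = record
              { isMagma = record { isEquivalence = isEquivalence ; ∙-cong = cong₂ _+K_ }
              ; assoc = +K-assoc }
            ; identity = +K-identityˡ , +K-identityʳ }
          ; inverse = -K-inverseˡ , -K-inverseʳ
          ; ⁻¹-cong = cong (λ x → -K x) }
        ; comm = +K-comm }
      ; *-cong = cong₂ _*K_
      ; *-assoc = *K-assoc
      ; *-identity = *K-identityˡ , *K-identityʳ
      ; distrib = *K-distribˡ-+K , *K-distribʳ-+K }
    ; *-comm = *K-comm }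

  +K-*K-commutativeRing : CommutativeRing 0ℓ 0ℓ
  +K-*K-commutativeRing = record { isCommutativeRing = +K-*K-isCommutativeRing }

  ι-homomorphism : ACR._-Raw-AlmostCommutative⟶_
                     (CommutativeRing.rawRing ℤP.+-*-commutativeRing)
                     (ACR.fromCommutativeRing +K-*K-commutativeRing)
  ι-homomorphism = record
    { ⟦_⟧    = ι
    ; +-homo = λ x y → cong (_+√· 0ℚ) (ℤ→ℚ-+ x y)
    ; *-homo = λ x y → cong₂ _+√·_
        (trans (ℤ→ℚ-* x y) (solve 3 (λ p q D → p :* q := p :* q :+ D :* (con 0ℚ :* con 0ℚ))
                                      refl (ℤ→ℚ x) (ℤ→ℚ y) Dℚ))
        (solve 2 (λ p q → con 0ℚ := p :* con 0ℚ :+ con 0ℚ :* q) refl (ℤ→ℚ x) (ℤ→ℚ y))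
    ; -‿homo = λ x → cong (_+√· 0ℚ) (ℤ→ℚ-neg x)
    ; 0-homo = refl
    ; 1-homo = refl }
    where open +-*-Solver

  ι-≟ : ∀ x y → Maybe (ι x ≡ ι y)
  ι-≟ x y with x ℤ.≟ y
  ... | yes x≡y = just (cong ι x≡y)
  ... | no _    = nothing

  open import Algebra.Solver.Ring (CommutativeRing.rawRing ℤP.+-*-commutativeRing)
    (ACR.fromCommutativeRing +K-*K-commutativeRing) ι-homomorphism ι-≟ public
    using (solve; _:+_; _:*_; :-_; _:=_; con)

  ι-neg : ∀ z → ι (ℤ.- z) ≡ -K ι z
  ι-neg = ACR._-Raw-AlmostCommutative⟶_.-‿homo ι-homomorphism

  ι-* : ∀ z w → ι (z ℤ.* w) ≡ ι z *K ι w
  ι-* = ACR._-Raw-AlmostCommutative⟶_.*-homo ι-homomorphism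

  ιℕ≢0K : ∀ n .{{_ : NonZero n}} → ιℕ n ≢ 0K
  ιℕ≢0K n ιn≡0 = ℕ.≢-nonZero⁻¹ n (cong ℤ.∣_∣ (ℤ→ℚ-injective {+ n} {+ 0} (cong re ιn≡0)))

  *K-zeroʳ : ∀ x → x *K 0K ≡ 0K
  *K-zeroʳ = solve 1 (λ x → x :* con (+ 0) := con (+ 0)) refl

  *K-zeroˡ : ∀ x → 0K *K x ≡ 0K
  *K-zeroˡ = solve 1 (λ x → con (+ 0) :* x := con (+ 0)) refl

  invK-0K : invK 0K ≡ 0K
  invK-0K = cong₂ _+√·_ (ℚP.*-zeroˡ (invℚ (norm 0K))) (ℚP.*-zeroˡ (invℚ (norm 0K)))

  1K≢0K : 1K ≢ 0K
  1K≢0K ()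

  -1K≢0K : -K 1K ≢ 0K
  -1K≢0K ()

  x*y≢0⇒x≢0 : ∀ {x y} → x *K y ≢ 0K → x ≢ 0K
  x*y≢0⇒x≢0 {y = y} xy≢0 refl = xy≢0 (*K-zeroˡ y)

module KField (D : ℕ) (D-nonSquare : ¬ IsRationalSquare D) where
  open QF D
  open KRing D

  norm≡0⇒≡0K : ∀ x → norm x ≡ 0ℚ → x ≡ 0K
  norm≡0⇒≡0K (a +√· b) norm≡0
    with square≡D*square⇒≡0 {D} D-nonSquare a b (x∙y⁻¹≈ε⇒x≈y (a ℚ.* a) (Dℚ ℚ.* (b ℚ.* b)) norm≡0)
  ... | refl , refl = refl

  *K-inverseʳ : ∀ x → x ≢ 0K → x *K invK x ≡ 1K
  *K-inverseʳ x x≢0 = *K-invK x (λ norm≡0 → x≢0 (norm≡0⇒≡0K x norm≡0))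

  *K-cancelʳ : ∀ {x y z} → z ≢ 0K → x *K z ≡ y *K z → x ≡ y
  *K-cancelʳ {x} {y} {z} z≢0 xz≡yz = begin
    x                    ≡⟨ sym (cancel x) ⟩
    (x *K z) *K invK z   ≡⟨ cong (_*K invK z) xz≡yz ⟩
    (y *K z) *K invK z   ≡⟨ cancel y ⟩
    y                    ∎
    where
    open ≡-Reasoning
    cancel : ∀ w → (w *K z) *K invK z ≡ w
    cancel w = begin
      (w *K z) *K invK z ≡⟨ *K-assoc w z (invK z) ⟩
      w *K (z *K invK z) ≡⟨ cong (w *K_) (*K-inverseʳ z z≢0) ⟩
      w *K 1K            ≡⟨ *K-identityʳ w ⟩
      w                  ∎

  *K-≢0 : ∀ {x y} → x ≢ 0K → y ≢ 0K → x *K y ≢ 0K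
  *K-≢0 {x} {y} x≢0 y≢0 xy≡0 = y≢0 (*K-cancelʳ x≢0 (trans (*K-comm y x) (trans xy≡0 (sym (*K-zeroˡ x)))))

  /K-*K : ∀ x {y} → y ≢ 0K → (x /K y) *K y ≡ x
  /K-*K x {y} y≢0 = begin
    (x *K invK y) *K y ≡⟨ *K-assoc x (invK y) y ⟩
    x *K (invK y *K y) ≡⟨ cong (x *K_) (trans (*K-comm (invK y) y) (*K-inverseʳ y y≢0)) ⟩
    x *K 1K            ≡⟨ *K-identityʳ x ⟩
    x                  ∎
    where open ≡-Reasoning

  *K≡⇒≡/K : ∀ {x y z} → y ≢ 0K → z *K y ≡ x → z ≡ x /K y
  *K≡⇒≡/K {x} y≢0 zy≡x = *K-cancelʳ y≢0 (trans zy≡x (sym (/K-*K x y≢0)))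

module Fricke (D : ℕ) (D-nonSquare : ¬ IsRationalSquare D) where
  open QF D
  open KRing D
  open KField D D-nonSquare

  -- y = -1/(M x), stated without division
  FrickePartners : ℕ → K → K → Set
  FrickePartners M x y = x *K (ιℕ M *K y) ≡ -K 1K

  FrickePartners-sym : ∀ {M x y} → FrickePartners M x y → FrickePartners M y x
  FrickePartners-sym {M} {x} {y} xy =
    trans (solve 3 (λ y m x → y :* (m :* x) := x :* (m :* y)) refl y (ιℕ M) x) xy

  star-FrickePartners : ∀ f N {τ} → ιℕ (f * N) ≢ 0K → τ ≢ 0K → FrickePartners (f * N) (star f N τ) τ
  star-FrickePartners f N M≢0 τ≢0 = /K-*K (-K 1K) (*K-≢0 M≢0 τ≢0)

  mob-FrickePartners : ∀ {M a b k d x y x' y'} → FrickePartners M x y → FrickePartners M x' y' →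
                       x' ≡ mob a b (k ℤ.* + M) d x → y' ≡ mob d (ℤ.- k) (ℤ.- (+ M ℤ.* b)) a y
  mob-FrickePartners {M} {a} {b} {k} {d} {x} {y} {x'} {y'} xy x'y' x'≡ = *K≡⇒≡/K Q≢0 y'Q≡P
    where
    open ≡-Reasoning
    m A C P Q V : K
    m = ιℕ M
    A = ι a *K x +K ι b
    C = ι (k ℤ.* + M) *K x +K ι d
    P = ι d *K y +K ι (ℤ.- k)
    Q = ι (ℤ.- (+ M ℤ.* b)) *K y +K ι a
    V = (-K m) *K x
    -- V = 1/y; multiplying by it clears every denominator.

    Vy≡1 : V *K y ≡ 1K
    Vy≡1 = begin
      (-K m) *K x *K y            ≡⟨ solve 3 (λ m x y → (:- m) :* x :* y := :- (x :* (m :* y))) refl m x y ⟩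
      -K (x *K (m *K y))          ≡⟨ cong -K_ xy ⟩
      -K (-K 1K)                  ≡⟨ solve 0 (:- (:- con (+ 1)) := con (+ 1)) refl ⟩
      1K                          ∎

    PV≡C : P *K V ≡ C
    PV≡C = begin
      (ι d *K y +K ι (ℤ.- k)) *K V    ≡⟨ cong (λ w → (ι d *K y +K w) *K V) (ι-neg k) ⟩
      (ι d *K y +K -K ι k) *K V       ≡⟨ solve 5 (λ d y k m x → (d :* y :+ :- k) :* ((:- m) :* x)
                                                  := d :* (:- (x :* (m :* y))) :+ k :* m :* x)
                                              refl (ι d) y (ι k) m x ⟩
      ι d *K (-K (x *K (m *K y))) +K ι k *K m *K x ≡⟨ cong (λ w → ι d *K (-K w) +K ι k *K m *K x) xy ⟩
      ι d *K (-K (-K 1K)) +K ι k *K m *K x        ≡⟨ solve 4 (λ d k m x → d :* (:- (:- con (+ 1))) :+ k :* m :* x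
                                                              := k :* m :* x :+ d)
                                                          refl (ι d) (ι k) m x ⟩
      ι k *K m *K x +K ι d                        ≡⟨ cong (λ w → w *K x +K ι d) (sym (ι-* k (+ M))) ⟩
      C                                           ∎

    QV≡-mA : Q *K V ≡ -K (m *K A)
    QV≡-mA = begin
      (ι (ℤ.- (+ M ℤ.* b)) *K y +K ι a) *K V ≡⟨ cong (λ w → (w *K y +K ι a) *K V)
                                                  (trans (ι-neg (+ M ℤ.* b)) (cong -K_ (ι-* (+ M) b))) ⟩
      (-K (m *K ι b) *K y +K ι a) *K V       ≡⟨ solve 5 (λ m b y a x → (:- (m :* b) :* y :+ a) :* ((:- m) :* x)
                                                          := m :* b :* (x :* (m :* y)) :+ :- (m :* a :* x))
                                                      refl m (ι b) y (ι a) x ⟩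
      m *K ι b *K (x *K (m *K y)) +K -K (m *K ι a *K x) ≡⟨ cong (λ w → m *K ι b *K w +K -K (m *K ι a *K x)) xy ⟩
      m *K ι b *K (-K 1K) +K -K (m *K ι a *K x)         ≡⟨ solve 4 (λ m b a x → m :* b :* (:- con (+ 1)) :+ :- (m :* a :* x)
                                                                    := :- (m :* (a :* x :+ b)))
                                                                refl m (ι b) (ι a) x ⟩
      -K (m *K A)                                       ∎

    x'≢0 : x' ≢ 0K
    x'≢0 = x*y≢0⇒x≢0 (λ eq → -1K≢0K (trans (sym x'y') eq))

    C≢0 : C ≢ 0K
    C≢0 C≡0 = x'≢0 (begin
      x'            ≡⟨ x'≡ ⟩
      A *K invK C   ≡⟨ cong (λ w → A *K invK w) C≡0 ⟩
      A *K invK 0K  ≡⟨ cong (A *K_) invK-0K ⟩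
      A *K 0K       ≡⟨ *K-zeroʳ A ⟩
      0K            ∎)

    x'C≡A : x' *K C ≡ A
    x'C≡A = trans (cong (_*K C) x'≡) (/K-*K A C≢0)

    y'QV≡PV : (y' *K Q) *K V ≡ P *K V
    y'QV≡PV = begin
      (y' *K Q) *K V            ≡⟨ *K-assoc y' Q V ⟩
      y' *K (Q *K V)            ≡⟨ cong (y' *K_) QV≡-mA ⟩
      y' *K (-K (m *K A))       ≡⟨ cong (λ w → y' *K (-K (m *K w))) (sym x'C≡A) ⟩
      y' *K (-K (m *K (x' *K C))) ≡⟨ solve 4 (λ y m x c → y :* (:- (m :* (x :* c))) := :- (x :* (m :* y)) :* c)
                                            refl y' m x' C ⟩
      -K (x' *K (m *K y')) *K C ≡⟨ cong (λ w → -K w *K C) x'y' ⟩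
      -K (-K 1K) *K C           ≡⟨ solve 1 (λ c → :- (:- con (+ 1)) :* c := c) refl C ⟩
      C                         ≡⟨ sym PV≡C ⟩
      P *K V                    ∎

    V≢0 : V ≢ 0K
    V≢0 = x*y≢0⇒x≢0 (λ eq → 1K≢0K (trans (sym Vy≡1) eq))

    y'Q≡P : y' *K Q ≡ P
    y'Q≡P = *K-cancelʳ V≢0 y'QV≡PV

    Q≢0 : Q ≢ 0K
    Q≢0 Q≡0 = C≢0 (begin
      C            ≡⟨ sym PV≡C ⟩
      P *K V       ≡⟨ cong (_*K V) (sym y'Q≡P) ⟩
      y' *K Q *K V ≡⟨ cong (λ w → y' *K w *K V) Q≡0 ⟩
      y' *K 0K *K V ≡⟨ cong (_*K V) (*K-zeroʳ y') ⟩
      0K *K V      ≡⟨ *K-zeroˡ V ⟩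
      0K           ∎)

  Sim-FrickePartners : ∀ f N {r r' x x' y y'} → FrickePartners (f * N) x y → FrickePartners (f * N) x' y' →
                       Sim f N r x r' x' → Sim f N r' y r y'
  Sim-FrickePartners f N {r} {r'} xy x'y' (a , b , c , d , det , fN∣c , (e , ed≡1 , er≡r') , x'≡)
    with ℤS.∣ᵤ⇒∣ {+ (f * N)} {c} fN∣c
  ... | ℤS.divides k refl =
      d , ℤ.- k , ℤ.- (+ (f * N) ℤ.* b) , a
    , trans (det-conjugate a b d k (+ (f * N))) det
    , ℤS.∣⇒∣ᵤ (ℤS.∣m⇒∣-m (ℤS.∣m⇒∣m*n b (ℤS.∣-refl {+ (f * N)})))
    , (d , det≡1⇒Cong-*-inverse f a b _ d det (ℤS.∣n⇒∣m*n k f∣fN) , Cong-*-invert f d e r r' ed≡1 er≡r')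
    , mob-FrickePartners {f * N} {a} {b} {k} {d} xy x'y' x'≡
    where
    det-conjugate : ∀ a b d k M → d ℤ.* a ℤ.- (ℤ.- k) ℤ.* (ℤ.- (M ℤ.* b)) ≡ a ℤ.* d ℤ.- b ℤ.* (k ℤ.* M)
    det-conjugate = solve-∀
    f∣fN : + f ℤS.∣ + (f * N)
    f∣fN = subst (+ f ℤS.∣_) (sym (ℤP.pos-* f N)) (ℤS.∣m⇒∣m*n (+ N) ℤS.∣-refl)

lemma9p1 : (D : ℕ) → 1 < D → SquareFree D →
           (φs : List Factor) → QF.ValidFactors D φs →
           (f : ℕ) → 0 < f → Coprime f (QF.NOf D φs * QF.dK D) →
           (O : Subset) → QF.IsOrder D O →
           (r r' : ℤ) (τ τ' : K) →
           QF.H D O (QF.NOf D φs) (QF.𝔑Of D φs) τ →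
           QF.H D O (QF.NOf D φs) (QF.𝔑Of D φs) τ' →
           (QF.Sim D f (QF.NOf D φs) r τ r' τ'
             ⇔ QF.Sim D f (QF.NOf D φs) r' (QF.star D f (QF.NOf D φs) τ) r (QF.star D f (QF.NOf D φs) τ'))
lemma9p1 D 1<D D-squareFree φs (_ , valid) f f>0 _ _ _ _ _ τ τ' Hτ Hτ' =
  mk⇔ (Sim-FrickePartners f N (FrickePartners-sym {f * N} {star f N τ} τ*τ)
                               (FrickePartners-sym {f * N} {star f N τ'} τ'*τ'))
      (Sim-FrickePartners f N τ*τ τ'*τ')
  where
  open QF D
  open KRing D using (ιℕ≢0K)
  open Fricke D (squareFree⇒¬IsRationalSquare 1<D D-squareFree)
  N : ℕ
  N = NOf φs
  M≢0 : ιℕ (f * N) ≢ 0K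
  M≢0 = ιℕ≢0K (f * N) {{ℕP.m*n≢0 f N {{ℕ.>-nonZero f>0}} {{NOf-nonZero valid}}}}
  τ*τ : FrickePartners (f * N) (star f N τ) τ
  τ*τ = star-FrickePartners f N M≢0 (λ τ≡0 → proj₁ Hτ (cong im τ≡0))
  τ'*τ' : FrickePartners (f * N) (star f N τ') τ'
  τ'*τ' = star-FrickePartners f N M≢0 (λ τ'≡0 → proj₁ Hτ' (cong im τ'≡0))
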